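{- Let $X,Y$ be infinite sets and $\Phi\subseteq X\times Y$. If $\mathrm{vc}(\Phi)>0$, then $\Phi$ is unstable, or at least one of $\Phi$, $\neg\Phi$ has infinite breadth.
   Context: For $y\in Y$ let $\Phi_y=\{x\in X:(x,y)\in\Phi\}$ and $\mathcal S_\Phi=\{\Phi_y:y\in Y\}$; $\neg\Phi=(X\times Y)\setminus\Phi$. The shatter function of a set system $\mathcal S$ on $X$ is $\pi_{\mathcal S}(n)=\max\{|\{S\cap A:S\in\mathcal S\}|:A\subseteq X,|A|=n\}$ and $\mathrm{vc}(\mathcal S)=\limsup_n\log\pi_{\mathcal S}(n)/\log n$ (with $\mathrm{vc}(\emptyset)=-1$); $\mathrm{vc}(\Phi)=\mathrm{vc}(\mathcal S_\Phi)$. An $n$-ladder for $\Phi$ is a tuple $(a_1,\dots,a_n,b_1,\dots,b_n)$ with $a_i\in X$, $b_j\in Y$ and $(a_i,b_j)\in\Phi\iff i\le j$ for all $i,j\in\{1,\dots,n\}$; $\Phi$ is stable if for some $n$ there is no $n$-ladder, unstable otherwise. The breadth of a family $\mathcal B$ of subsets of a set is the smallest integer $d>0$ such that every nonempty intersection $B_1\cap\dots\cap B_n$ of $n>d$ members of $\mathcal B$ equals the intersection of some $d$ of the $B_i$; if no such $d$ exists, $\mathcal B$ has infinite breadth. The breadth of $\Phi$ is the breadth of $\mathcal S_\Phi$. -}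

module Defs where

open import Data.Nat using (ℕ; suc; _≤_; _^_)
open import Data.Fin using (Fin; toℕ)
open import Data.Product using (Σ; ∃; ∃-syntax; _×_)
open import Relation.Nullary using (¬_)
open import Function.Bundles using (_↔_; _⇔_)
open import Function.Definitions using (Injective)
open import Relation.Binary.PropositionalEquality using (_≡_)

Rel : Set → Set → Set₁
Rel X Y = X → Y → Set

negRel : {X Y : Set} → Rel X Y → Rel X Y
negRel Φ x y = ¬ Φ x y

Finite : Set → Set
Finite X = ∃[ n ] (X ↔ Fin n)

Infinite : Set → Set
Infinite X = ¬ Finite X

-- "π_{S_Φ}(n) ≥ k": there is an n-element set A ⊆ X (given by an injection
-- a : Fin n → X) and k members Φ_{y_1},…,Φ_{y_k} whose traces on A are
-- pairwise distinct.
ShatterAtLeast : {X Y : Set} → Rel X Y → ℕ → ℕ → Set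
ShatterAtLeast {X} {Y} Φ n k =
  Σ (Fin n → X) λ a → Injective _≡_ _≡_ a ×
  Σ (Fin k → Y) λ y →
    ∀ i j → ¬ (i ≡ j) → ¬ (∀ m → Φ (a m) (y i) ⇔ Φ (a m) (y j))

-- vc(Φ) > 0, i.e. limsup_n log π(n) / log n > 0:
-- there is a rational ε = p/q > 0 such that for infinitely many n
-- (n ≥ 2, so log n > 0) we have π(n)^q ≥ n^p, i.e. log π(n)/log n ≥ ε.
VCPositive : {X Y : Set} → Rel X Y → Set
VCPositive Φ =
  ∃[ p ] ∃[ q ] ∀ N → ∃[ n ] (N ≤ n × 2 ≤ n ×
     ∃[ k ] (n ^ suc p ≤ k ^ suc q × ShatterAtLeast Φ n k))

Ladder : {X Y : Set} → Rel X Y → ℕ → Set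
Ladder {X} {Y} Φ n =
  Σ (Fin n → X) λ a → Σ (Fin n → Y) λ b →
    ∀ i j → Φ (a i) (b j) ⇔ (toℕ i ≤ toℕ j)

Stable : {X Y : Set} → Rel X Y → Set
Stable Φ = ∃[ n ] ¬ Ladder Φ n

Unstable : {X Y : Set} → Rel X Y → Set
Unstable Φ = ¬ Stable Φ

BreadthBound : {X Y : Set} → Rel X Y → ℕ → Set
BreadthBound {X} {Y} Φ d =
  1 ≤ d ×
  (∀ n → suc d ≤ n → (y : Fin n → Y) →
     (∃[ x ] ∀ i → Φ x (y i)) →
     Σ (Fin d → Fin n) λ σ → Injective _≡_ _≡_ σ ×
       (∀ x → (∀ i → Φ x (y i)) ⇔ (∀ j → Φ x (y (σ j)))))

FiniteBreadth : {X Y : Set} → Rel X Y → Set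
FiniteBreadth Φ = ∃[ d ] BreadthBound Φ d

InfiniteBreadth : {X Y : Set} → Rel X Y → Set
InfiniteBreadth Φ = ¬ FiniteBreadth Φ

{-# OPTIONS --safe #-}
-- Decide Φ by excluded middle and view it as a Boolean matrix φ. Positive VC
-- dimension yields arbitrarily large families of columns with pairwise distinct
-- traces. Repeatedly splitting such a family by a point on which two of its
-- members disagree, keeping the larger half and setting aside one of the two,
-- gives a long chain of (point, column) pairs in which every row is constant to
-- the right of the diagonal and flips on it. Halving once more, Ramsey-style,
-- makes every column constant below the diagonal, and two majority votes give a
-- square pattern of any prescribed size with
--   φ (row i) (col j) = α for i < j,   not α for i = j,   β for i > j.
-- The four choices of (α, β) yield a strict ladder, a reversed ladder, and an
-- antidiagonal for Φ or for ¬Φ, and an antidiagonal of size d + 2 contradicts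
-- breadth d.
module Submission where

open import Defs
open import Level using (0ℓ)
open import Axiom.ExcludedMiddle using (ExcludedMiddle)
open import Function using (_∘_; case_of_)
open import Function.Bundles using (_⇔_; mk⇔; Equivalence)
open import Function.Definitions using (Injective)
open import Data.Bool using (Bool; true; false; not)
open import Data.Bool.Properties using (_≟_)
open import Data.Empty using (⊥-elim)
open import Data.Sum using (_⊎_; inj₁; inj₂)
open import Data.Product using (∃₂; ∃-syntax; _×_; _,_; proj₁; proj₂)
open import Data.Nat using (ℕ; zero; suc; _+_; _^_; _≤_; _<_; z≤n; s≤s; s≤s⁻¹; _≤?_)
open import Data.Nat.Properties
  using (≤-refl; ≤-trans; m≤n⇒m≤1+n; m≤m+n; m≤n+m; m≤m*n; m^n>0; m^n≢0; +-identityʳ; +-suc;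
         +-mono-≤; <⇒≤; <⇒≱; ≰⇒>; ≮⇒≥; ^-monoˡ-<; m<n⇒m<1+n; n<1+n; ∸-monoʳ-<)
open import Data.Fin as Fin using (Fin; toℕ; inject₁; inject≤; opposite)
open import Data.Fin.Properties
  using (toℕ<n; toℕ-inject₁; toℕ-inject≤; opposite-prop; suc-injective; <-cmp; any?; all?; ¬∀⟶∃¬;
         <⇒notInjective)
open import Data.List using (List; []; _∷_; length; filter; lookup; tabulate)
open import Data.List.Properties using (length-tabulate)
open import Data.List.Membership.Propositional using (_∈_)
open import Data.List.Membership.Propositional.Properties using (∈-filter⁻; ∈-lookup)
open import Data.List.Relation.Unary.Any using (here; there)
open import Data.List.Relation.Unary.All as All using (All; []; _∷_)
open import Data.List.Relation.Unary.All.Properties using (all-filter)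
  renaming (filter⁺ to All-filter⁺)
open import Data.List.Relation.Unary.AllPairs using (AllPairs; []; _∷_)
open import Data.List.Relation.Unary.AllPairs.Properties using ()
  renaming (filter⁺ to AllPairs-filter⁺; tabulate⁺ to AllPairs-tabulate⁺)
open import Relation.Nullary using (¬_; yes; no; does; contradiction)
open import Relation.Nullary.Decidable using (¬?; dec-true; decidable-stable)
open import Relation.Unary using () renaming (Decidable to Decidable₁)
open import Relation.Binary.Definitions using (Decidable; tri<; tri≈; tri>)
open import Relation.Binary.PropositionalEquality
  using (_≡_; _≢_; refl; sym; trans; cong; subst; subst₂)

one-is-not : ∀ {u v} b → u ≢ v → u ≡ not b ⊎ v ≡ not b
one-is-not {false} {false} _ u≢v = contradiction refl u≢v
one-is-not {true}  {true}  _ u≢v = contradiction refl u≢v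
one-is-not {false} {true}  false _ = inj₂ refl
one-is-not {false} {true}  true  _ = inj₁ refl
one-is-not {true}  {false} false _ = inj₁ refl
one-is-not {true}  {false} true  _ = inj₂ refl

2≤2^[1+u] : ∀ u → 2 ≤ 2 ^ suc u
2≤2^[1+u] u = m≤m*n 2 (2 ^ u) {{m^n≢0 2 u}}

halve-2^ : ∀ u {n} → 2 ^ suc u ≤ n → 2 ^ u + 2 ^ u ≤ n
halve-2^ u {n} = subst (_≤ n) (cong (2 ^ u +_) (+-identityʳ (2 ^ u)))

module _ {A : Set} (c : A → Bool) where

  coloured? : (b : Bool) → Decidable₁ (λ x → c x ≡ b)
  coloured? b x = c x ≟ b

  colour-class : Bool → List A → List A
  colour-class b = filter (coloured? b)

  length-colour-classes : ∀ xs →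
    length (colour-class true xs) + length (colour-class false xs) ≡ length xs
  length-colour-classes [] = refl
  length-colour-classes (x ∷ xs) with c x
  ... | true  = cong suc (length-colour-classes xs)
  ... | false = trans (+-suc _ _) (cong suc (length-colour-classes xs))

  majority-class : ∀ s xs → s + s ≤ suc (length xs) → ∃[ b ] s ≤ length (colour-class b xs)
  majority-class s xs bound
    with s ≤? length (colour-class true xs) | s ≤? length (colour-class false xs)
  ... | yes many | _        = true , many
  ... | no _     | yes many = false , many
  ... | no few-t | no few-f = contradiction (≤-trans both-small bound) (<⇒≱ (n<1+n (suc (length xs))))
    where
    both-small : suc (suc (length xs)) ≤ s + s
    both-small = subst (_≤ s + s)
      (trans (+-suc (suc (length (colour-class true xs))) (length (colour-class false xs)))
             (cong (suc ∘ suc) (length-colour-classes xs)))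
      (+-mono-≤ (≰⇒> few-t) (≰⇒> few-f))

AllPairs-lookup : ∀ {A : Set} {R : A → A → Set} {xs} → AllPairs R xs →
  ∀ {i j : Fin (length xs)} → i Fin.< j → R (lookup xs i) (lookup xs j)
AllPairs-lookup (Rx ∷ _)   {Fin.zero}  {Fin.suc j} _   = All.lookup Rx (∈-lookup j)
AllPairs-lookup (_  ∷ Rxs) {Fin.suc i} {Fin.suc j} i<j = AllPairs-lookup Rxs (s≤s⁻¹ i<j)

opposite-reverses-< : ∀ {n} {i j : Fin n} → i Fin.< j → opposite j Fin.< opposite i
opposite-reverses-< {i = i} {j} i<j = subst₂ _<_ (sym (opposite-prop j)) (sym (opposite-prop i))
  (∸-monoʳ-< (s≤s i<j) (toℕ<n j))

missing-value : ∀ {d} (σ : Fin d → Fin (suc d)) → ∃[ k ] ∀ j → σ j ≢ k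
missing-value {d} σ with any? (λ k → all? (λ j → ¬? (σ j Fin.≟ k)))
... | yes found = found
... | no none = ⊥-elim (<⇒notInjective (n<1+n d) section-injective)
  where
  preimage : ∀ k → ∃[ j ] σ j ≡ k
  preimage k with j , ¬¬hit ← ¬∀⟶∃¬ d _ (λ j → ¬? (σ j Fin.≟ k)) (none ∘ (k ,_)) =
    j , decidable-stable (σ j Fin.≟ k) ¬¬hit
  section-injective : Injective _≡_ _≡_ (proj₁ ∘ preimage)
  section-injective {k} {k′} eq =
    trans (sym (proj₂ (preimage k))) (trans (cong σ eq) (proj₂ (preimage k′)))

-- Any d of the columns col 1, …, col (d+1) miss some col k, and row k lies in
-- all columns but col k; row 0 makes the intersection nonempty.
antidiagonal⇒¬BreadthBound : ∀ {X Y : Set} {Ψ : Rel X Y} {d}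
  (row : Fin (2 + d) → X) (col : Fin (2 + d) → Y) →
  (∀ {i j} → i ≢ j → Ψ (row i) (col j)) → (∀ i → ¬ Ψ (row i) (col i)) → ¬ BreadthBound Ψ d
antidiagonal⇒¬BreadthBound {d = d} row col off diag (_ , bound)
  with σ , _ , same ← bound (suc d) ≤-refl (col ∘ Fin.suc) (row Fin.zero , λ _ → off (λ ()))
  with k , σ≢k ← missing-value σ =
  diag (Fin.suc k)
    (Equivalence.from (same (row (Fin.suc k))) (λ j → off (σ≢k j ∘ sym ∘ suc-injective)) k)

module Matrix {X Y : Set} (φ : X → Y → Bool) where

  record Pattern (L : ℕ) (α δ β : Bool) : Set where
    field
      row      : Fin L → X
      col      : Fin L → Y
      above    : ∀ {i j} → i Fin.< j → φ (row i) (col j) ≡ α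
      diagonal : ∀ i → φ (row i) (col i) ≡ δ
      below    : ∀ {i j} → j Fin.< i → φ (row i) (col j) ≡ β

  off-diagonal : ∀ {L α δ} (P : Pattern L α δ α) → let open Pattern P in
    ∀ {i j} → i ≢ j → φ (row i) (col j) ≡ α
  off-diagonal P {i} {j} i≢j with <-cmp i j
  ... | tri< i<j _ _ = Pattern.above P i<j
  ... | tri≈ _ i≡j _ = contradiction i≡j i≢j
  ... | tri> _ _ j<i = Pattern.below P j<i

  restrict : ∀ {L L′ α δ β} → L′ ≤ L → Pattern L α δ β → Pattern L′ α δ β
  restrict L′≤L P = record
    { row      = row ∘ embed
    ; col      = col ∘ embed
    ; above    = λ i<j → above (embed-mono i<j)
    ; diagonal = diagonal ∘ embed
    ; below    = λ j<i → below (embed-mono j<i)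
    }
    where
    open Pattern P
    embed : Fin _ → Fin _
    embed i = inject≤ i L′≤L
    embed-mono : ∀ {i j} → i Fin.< j → embed i Fin.< embed j
    embed-mono {i} {j} = subst₂ _<_ (sym (toℕ-inject≤ i L′≤L)) (sym (toℕ-inject≤ j L′≤L))

  reverse : ∀ {L α δ β} → Pattern L α δ β → Pattern L β δ α
  reverse P = record
    { row      = row ∘ opposite
    ; col      = col ∘ opposite
    ; above    = below ∘ opposite-reverses-<
    ; diagonal = diagonal ∘ opposite
    ; below    = above ∘ opposite-reverses-<
    }
    where open Pattern P

  -- Pairing row i with column i + 1 moves the old diagonal below the new one.
  shift : ∀ {m α β} → Pattern (suc m) α β β → Pattern m α α β
  shift {m} {α} {β} P = record
    { row      = row ∘ inject₁
    ; col      = col ∘ Fin.suc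
    ; above    = λ i<j → above (inject₁<suc (m<n⇒m<1+n i<j))
    ; diagonal = λ i → above (inject₁<suc (n<1+n (toℕ i)))
    ; below    = below′
    }
    where
    open Pattern P
    inject₁<suc : ∀ {i j : Fin m} → toℕ i < suc (toℕ j) → inject₁ i Fin.< Fin.suc j
    inject₁<suc {i} = subst (_< _) (sym (toℕ-inject₁ i))
    below′ : ∀ {i j : Fin m} → j Fin.< i → φ (row (inject₁ i)) (col (Fin.suc j)) ≡ β
    below′ {i} {j} j<i with <-cmp (Fin.suc j) (inject₁ i)
    ... | tri< j+1<i _ _ = below j+1<i
    ... | tri≈ _ j+1≡i _ = subst (λ k → φ (row k) (col (Fin.suc j)) ≡ β) j+1≡i (diagonal (Fin.suc j))
    ... | tri> _ _ i<j+1 =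
      contradiction (subst (_≤ toℕ j) (toℕ-inject₁ i) (s≤s⁻¹ i<j+1)) (<⇒≱ j<i)

  Distinguished : Y → Y → Set
  Distinguished y y′ = ∃[ x ] φ x y ≢ φ x y′

  -- The pivot separates its witness from all columns kept after the split.
  record Split : Set where
    constructor split
    field
      pivot   : X
      witness : Y
      side    : Bool
  open Split

  Separated : Split → Set
  Separated t = φ (pivot t) (witness t) ≡ not (side t)

  Nested : Split → Split → Set
  Nested t t′ = φ (pivot t) (witness t′) ≡ side t

  splitting-chain : ∀ u (ys : List Y) → AllPairs Distinguished ys → 2 ^ u ≤ length ys →
    ∃[ ts ] u ≤ length ts × AllPairs Nested ts × All Separated ts × All (λ t → witness t ∈ ys) ts
  splitting-chain zero _ _ _ = [] , z≤n , [] , [] , []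
  splitting-chain (suc u) []       _ big = contradiction (≤-trans (2≤2^[1+u] u) big) λ ()
  splitting-chain (suc u) (_ ∷ []) _ big = contradiction (≤-trans (2≤2^[1+u] u) big) λ { (s≤s ()) }
  splitting-chain (suc u) ys@(y₁ ∷ y₂ ∷ _) distinct@(((x , y₁≉y₂) ∷ _) ∷ _) big
    with b , half ← majority-class (φ x) (2 ^ u) ys
                      (halve-2^ u (m≤n⇒m≤1+n big))
    with ts , long , nested , separated , kept ←
           splitting-chain u (colour-class (φ x) b ys) (AllPairs-filter⁺ (coloured? (φ x) b) distinct) half =
    split x w b ∷ ts , s≤s long ,
    All.map (proj₂ ∘ ∈-filter⁻ (coloured? (φ x) b)) kept ∷ nested ,
    w-separated ∷ separated ,
    w∈ys ∷ All.map (proj₁ ∘ ∈-filter⁻ (coloured? (φ x) b)) kept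
    where
    far-witness : ∃[ w ] φ x w ≡ not b × w ∈ ys
    far-witness with one-is-not b y₁≉y₂
    ... | inj₁ e = y₁ , e , here refl
    ... | inj₂ e = y₂ , e , there (here refl)
    w = proj₁ far-witness
    w-separated = proj₁ (proj₂ far-witness)
    w∈ys = proj₂ (proj₂ far-witness)

  back : Split → Split → Bool
  back t t′ = φ (pivot t′) (witness t)

  Homogeneous : Split × Bool → Split × Bool → Set
  Homogeneous (t , β) (t′ , _) = Nested t t′ × back t t′ ≡ β

  coloured-subchain : ∀ u (ts : List Split) → AllPairs Nested ts → 2 ^ u ≤ length ts →
    ∃[ hs ] u ≤ length hs × AllPairs Homogeneous hs × All (λ h → proj₁ h ∈ ts) hs
  coloured-subchain zero _ _ _ = [] , z≤n , [] , []
  coloured-subchain (suc u) [] _ big = contradiction big (<⇒≱ (m^n>0 2 (suc u)))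
  coloured-subchain (suc u) (t ∷ ts) (t-nested ∷ nested) big
    with β , half ← majority-class (back t) (2 ^ u) ts (halve-2^ u big)
    with hs , long , homogeneous , kept ←
           coloured-subchain u (colour-class (back t) β ts) (AllPairs-filter⁺ (coloured? (back t) β) nested) half =
    (t , β) ∷ hs , s≤s long ,
    All.map head-homogeneous kept ∷ homogeneous ,
    here refl ∷ All.map (there ∘ proj₁ ∘ ∈-filter⁻ (coloured? (back t) β)) kept
    where
    head-homogeneous : ∀ {t′} → t′ ∈ colour-class (back t) β ts → Nested t t′ × back t t′ ≡ β
    head-homogeneous t′∈class with t′∈ts , back≡β ← ∈-filter⁻ (coloured? (back t) β) t′∈class =
      All.lookup t-nested t′∈ts , back≡β

  chain-pattern : ∀ {α β} (hs : List (Split × Bool)) → AllPairs Homogeneous hs →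
    All (Separated ∘ proj₁) hs → All (λ h → side (proj₁ h) ≡ α) hs → All (λ h → proj₂ h ≡ β) hs →
    Pattern (length hs) α (not α) β
  chain-pattern hs homogeneous separated sides backs = record
    { row      = pivot ∘ node
    ; col      = witness ∘ node
    ; above    = λ i<j → trans (proj₁ (AllPairs-lookup homogeneous i<j)) (at sides _)
    ; diagonal = λ i → trans (at separated i) (cong not (at sides i))
    ; below    = λ j<i → trans (proj₂ (AllPairs-lookup homogeneous j<i)) (at backs _)
    }
    where
    node : Fin (length hs) → Split
    node i = proj₁ (lookup hs i)
    at : ∀ {P : Split × Bool → Set} → All P hs → ∀ i → P (lookup hs i)
    at ps i = All.lookup ps (∈-lookup i)

  homogeneous-pattern : ∀ s (hs : List (Split × Bool)) → AllPairs Homogeneous hs →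
    All (Separated ∘ proj₁) hs → s + s + (s + s) ≤ length hs → ∃₂ λ α β → Pattern s α (not α) β
  homogeneous-pattern s hs homogeneous separated long
    with α , many-α ← majority-class (side ∘ proj₁) (s + s) hs (m≤n⇒m≤1+n long)
    with β , many-β ← majority-class proj₂ s (colour-class (side ∘ proj₁) α hs) (m≤n⇒m≤1+n many-α) =
    α , β , restrict many-β (chain-pattern (colour-class proj₂ β hsα)
      (AllPairs-filter⁺ by-β (AllPairs-filter⁺ by-α homogeneous))
      (All-filter⁺ by-β (All-filter⁺ by-α separated))
      (All-filter⁺ by-β (all-filter by-α hs))
      (all-filter by-β hsα))
    where
    hsα = colour-class (side ∘ proj₁) α hs
    by-α = coloured? (side ∘ proj₁) α
    by-β = coloured? proj₂ β

  pattern-in-distinguished : ∀ s (ys : List Y) → AllPairs Distinguished ys →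
    2 ^ 2 ^ (s + s + (s + s)) ≤ length ys → ∃₂ λ α β → Pattern s α (not α) β
  pattern-in-distinguished s ys distinct big
    with ts , long-ts , nested , separated , _ ← splitting-chain (2 ^ (s + s + (s + s))) ys distinct big
    with hs , long-hs , homogeneous , kept ← coloured-subchain (s + s + (s + s)) ts nested long-ts =
    homogeneous-pattern s hs homogeneous (All.map (All.lookup separated) kept) long-hs

arbitrarily-many-traces : ∀ {X Y : Set} {Φ : Rel X Y} → VCPositive Φ →
  ∀ B → ∃₂ λ n k → B ≤ k × ShatterAtLeast Φ n k
arbitrarily-many-traces (p , q , often) B with often (B ^ suc q)
... | n@(suc _) , B^q≤n , _ , k , n^p≤k^q , shatter = n , k , B≤k , shatter
  where
  B≤k : B ≤ k
  B≤k = ≮⇒≥ λ k<B → <⇒≱ (^-monoˡ-< (suc q) k<B)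
    (≤-trans B^q≤n (≤-trans (m≤m*n n (n ^ p) {{m^n≢0 n p}}) n^p≤k^q))

module Decided {X Y : Set} (Φ : Rel X Y) (Φ? : Decidable Φ) where

  φ : X → Y → Bool
  φ x y = does (Φ? x y)

  open Matrix φ

  φ-true : ∀ {x y} → φ x y ≡ true → Φ x y
  φ-true {x} {y} with Φ? x y
  ... | yes Φxy = λ _ → Φxy
  ... | no _    = λ ()

  φ-false : ∀ {x y} → φ x y ≡ false → ¬ Φ x y
  φ-false {x} {y} with Φ? x y
  ... | yes _    = λ ()
  ... | no ¬Φxy = λ _ → ¬Φxy

  φ-≡⇒⇔ : ∀ {x y x′ y′} → φ x y ≡ φ x′ y′ → Φ x y ⇔ Φ x′ y′
  φ-≡⇒⇔ {x} {y} {x′} {y′} eq = mk⇔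
    (λ Φxy → φ-true (trans (sym eq) (dec-true (Φ? x y) Φxy)))
    (λ Φx′y′ → φ-true (trans eq (dec-true (Φ? x′ y′) Φx′y′)))

  distinct-traces⇒Distinguished : ∀ {n} (a : Fin n → X) {y y′} →
    ¬ (∀ m → Φ (a m) y ⇔ Φ (a m) y′) → Distinguished y y′
  distinct-traces⇒Distinguished {n} a {y} {y′} differ
    with m , φ≢ ← ¬∀⟶∃¬ n _ (λ m → φ (a m) y ≟ φ (a m) y′) (differ ∘ (φ-≡⇒⇔ ∘_)) = a m , φ≢

  Pattern⇒Ladder : ∀ {m} → Pattern m true true false → Ladder Φ m
  Pattern⇒Ladder P = row , col , λ i j → mk⇔ (to i j) (from i j)
    where
    open Pattern P
    to : ∀ i j → Φ (row i) (col j) → i Fin.≤ j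
    to i j Φij with i Fin.≤? j
    ... | yes i≤j = i≤j
    ... | no i≰j  = contradiction Φij (φ-false (below (≰⇒> i≰j)))
    from : ∀ i j → i Fin.≤ j → Φ (row i) (col j)
    from i j i≤j with <-cmp i j
    ... | tri< i<j _ _ = φ-true (above i<j)
    ... | tri≈ _ refl _ = φ-true (diagonal i)
    ... | tri> _ _ j<i = contradiction i≤j (<⇒≱ j<i)

  Pattern⇒¬BreadthBound : ∀ {d} → Pattern (2 + d) true false true → ¬ BreadthBound Φ d
  Pattern⇒¬BreadthBound P = antidiagonal⇒¬BreadthBound {Ψ = Φ} row col
    (φ-true ∘ off-diagonal P) (φ-false ∘ diagonal)
    where open Pattern P

  Pattern⇒¬co-BreadthBound : ∀ {d} → Pattern (2 + d) false true false → ¬ BreadthBound (negRel Φ) d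
  Pattern⇒¬co-BreadthBound P = antidiagonal⇒¬BreadthBound {Ψ = negRel Φ} row col
    (φ-false ∘ off-diagonal P) (λ i ¬Φii → ¬Φii (φ-true (diagonal i)))
    where open Pattern P

  pattern-dichotomy : ∀ {L α β} m d₁ d₂ → suc m ≤ L → 2 + d₁ ≤ L → 2 + d₂ ≤ L →
    Pattern L α (not α) β → Ladder Φ m ⊎ (¬ BreadthBound Φ d₁ ⊎ ¬ BreadthBound (negRel Φ) d₂)
  pattern-dichotomy {α = true}  {false} _ _ _ m<L _ _ P = inj₁ (Pattern⇒Ladder (shift (restrict m<L P)))
  pattern-dichotomy {α = false} {true}  _ _ _ m<L _ _ P = inj₁ (Pattern⇒Ladder (restrict (<⇒≤ m<L) (reverse P)))
  pattern-dichotomy {α = true}  {true}  _ _ _ _ d₁<L _ P = inj₂ (inj₁ (Pattern⇒¬BreadthBound (restrict d₁<L P)))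
  pattern-dichotomy {α = false} {false} _ _ _ _ _ d₂<L P = inj₂ (inj₂ (Pattern⇒¬co-BreadthBound (restrict d₂<L P)))

  regular-pattern : VCPositive Φ → ∀ s → ∃₂ λ α β → Pattern s α (not α) β
  regular-pattern vc s
    with _ , _ , B≤k , a , _ , y , differ ← arbitrarily-many-traces {Φ = Φ} vc (2 ^ 2 ^ (s + s + (s + s))) =
    pattern-in-distinguished s (tabulate y)
      (AllPairs-tabulate⁺ (λ {i} {j} i≢j → distinct-traces⇒Distinguished a (differ i j i≢j)))
      (subst (_ ≤_) (sym (length-tabulate y)) B≤k)

  ladder-or-unbounded-breadth : VCPositive Φ → ∀ m d₁ d₂ →
    Ladder Φ m ⊎ (¬ BreadthBound Φ d₁ ⊎ ¬ BreadthBound (negRel Φ) d₂)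
  ladder-or-unbounded-breadth vc m d₁ d₂ =
    pattern-dichotomy m d₁ d₂ (m≤n⇒m≤1+n (s≤s m≤K)) (s≤s (s≤s d₁≤K)) (s≤s (s≤s d₂≤K))
      (proj₂ (proj₂ (regular-pattern vc (2 + K))))
    where
    K = m + d₁ + d₂
    m≤K = ≤-trans (m≤m+n m d₁) (m≤m+n (m + d₁) d₂)
    d₁≤K = ≤-trans (m≤n+m d₁ m) (m≤m+n (m + d₁) d₂)
    d₂≤K = m≤n+m d₂ (m + d₁)

proposition2p20 : ExcludedMiddle 0ℓ → {X Y : Set} → Infinite X → Infinite Y →
    (Φ : Rel X Y) → VCPositive Φ →
    Unstable Φ ⊎ (InfiniteBreadth Φ ⊎ InfiniteBreadth (negRel Φ))
proposition2p20 em _ _ Φ vc with em {Stable Φ} | em {FiniteBreadth Φ} | em {FiniteBreadth (negRel Φ)}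
... | no unstable | _     | _            = inj₁ unstable
... | yes _       | no unbounded | _     = inj₂ (inj₁ unbounded)
... | yes _       | yes _ | no unbounded = inj₂ (inj₂ unbounded)
... | yes (m , no-ladder) | yes (d₁ , bound₁) | yes (d₂ , bound₂) =
  case Decided.ladder-or-unbounded-breadth Φ (λ _ _ → em) vc m d₁ d₂ of λ where
    (inj₁ ladder)              → contradiction ladder no-ladder
    (inj₂ (inj₁ ¬bounded))     → contradiction bound₁ ¬bounded
    (inj₂ (inj₂ ¬co-bounded))  → contradiction bound₂ ¬co-bounded
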